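{- Let $H$ be a bipartite graph with no vertex of degree zero or one, with vertex set $S\uplus T$, $S=\{1,\dots,n\}$, $T=\{n+1,\dots,n+m\}$. Then the clique map $\phi:\mathcal{V}(H)\to\mathcal{C}(H)$ is well defined (i.e., $\phi(\mathbf{a})$ is a maximal clique of $G(H)$ with respect to the canonical bipartite framing for every clique vector $\mathbf{a}$) and is a bijection.
   Context: Every edge of $H$ joins a vertex of $S$ to a vertex of $T$; $N_H(v)$ denotes the neighborhood of $v$. The extension $G(H)$ is the directed multigraph obtained from $H$ (edges directed from $S$ to $T$) by adding vertices $s,t$; for each $i\in S$ two parallel edges $\alpha_{1,i},\alpha_{2,i}$ from $s$ to $i$; for each edge $ij$ of $H$ ($i\in S,j\in T$) the edge $\beta_{i,j}$ from $i$ to $j$; and for each $j\in T$ two parallel edges $\gamma_{j,1},\gamma_{j,2}$ from $j$ to $t$. A route is a directed path from $s$ to $t$; every route has the form $\alpha_{a,i}\beta_{i,j}\gamma_{j,b}$. The canonical bipartite framing orders the edges entering/leaving each inner vertex by $\alpha_{1,i}<\alpha_{2,i}$, $\gamma_{j,1}<\gamma_{j,2}$, $\beta_{i,j}<\beta_{i,k}$ if $j<k$, and $\beta_{j,i}<\beta_{k,i}$ if $j<k$. With respect to this framing, two routes are incoherent (in conflict) exactly when they are, for some indices, of one of the forms: (a) $\alpha_{1,i}\beta_{i,j}\gamma_{j,2}$ and $\alpha_{2,i}\beta_{i,j}\gamma_{j,1}$; (b) $\alpha_{1,i}\beta_{i,k}\gamma_{k,b}$ and $\alpha_{2,i}\beta_{i,j}\gamma_{j,b'}$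 with $j<k$; (c) $\alpha_{a,i}\beta_{i,j}\gamma_{j,2}$ and $\alpha_{a',i'}\beta_{i',j}\gamma_{j,1}$ with $i<i'$; otherwise they are coherent. A clique is a set of pairwise coherent routes; $\mathcal{C}(H)$ denotes the set of maximal (under inclusion) cliques. A clique vector is $\mathbf{a}=((a_v)_{v\in S\cup T},(a_{i,j})_{ij\in E(H)})$ with $a_v\in N_H(v)$ for every vertex $v$, and $a_{i,j}\in\{+,-\}$ where $a_{i,j}$ may equal $+$ only if $a_i=j$ and $a_j=i$ (otherwise $a_{i,j}=-$). $\mathcal{V}(H)$ is the set of clique vectors. The clique map $\phi$ sends $\mathbf{a}$ to the set of routes containing, for each edge $ij\in E(H)$ ($i\in S$, $j\in T$): (i) if $a_i\ne j$ and $a_j\ne i$: the single route $\alpha_{x,i}\beta_{i,j}\gamma_{j,y}$ with $x=2$ if $a_i<j$, $x=1$ if $a_i>j$, and $y=2$ if $a_j<i$, $y=1$ if $a_j>i$; (ii) if exactly one of $a_i=j$, $a_j=i$ holds: if $a_i=j$ and $a_j<i$, the routes $\alpha_{1,i}\beta_{i,j}\gamma_{j,2},\alpha_{2,i}\beta_{i,j}\gamma_{j,2}$; if $a_i=j$ and $a_j>i$, the routes $\alpha_{1,i}\beta_{i,j}\gamma_{j,1},\alpha_{2,i}\beta_{i,j}\gamma_{j,1}$; if $a_j=i$ and $a_i<j$, the routes $\alpha_{2,i}\beta_{i,j}\gamma_{j,1},\alpha_{2,i}\beta_{i,j}\gamma_{j,2}$; if $a_j=i$ and $a_i>j$, the routes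 $\alpha_{1,i}\beta_{i,j}\gamma_{j,1},\alpha_{1,i}\beta_{i,j}\gamma_{j,2}$; (iii) if $a_i=j$ and $a_j=i$: if $a_{i,j}=-$, the routes $\alpha_{1,i}\beta_{i,j}\gamma_{j,1},\alpha_{1,i}\beta_{i,j}\gamma_{j,2},\alpha_{2,i}\beta_{i,j}\gamma_{j,2}$; if $a_{i,j}=+$, the routes $\alpha_{1,i}\beta_{i,j}\gamma_{j,1},\alpha_{2,i}\beta_{i,j}\gamma_{j,1},\alpha_{2,i}\beta_{i,j}\gamma_{j,2}$. -}

module Defs where

open import Data.Nat using (ℕ)
open import Data.Fin using (Fin; _<_)
open import Data.Fin.Properties using (<-cmp)
open import Data.Bool using (Bool; true; false; _∧_; not)
open import Data.Product using (Σ; ∃; _×_; _,_)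
open import Relation.Binary.Definitions using (tri<; tri≈; tri>)
open import Relation.Binary.PropositionalEquality using (_≡_; _≢_)
open import Relation.Nullary using (¬_)

-- A bipartite graph H on S ⊎ T with S = {1..n} (as Fin n) and T = {n+1..n+m}
-- (as Fin m, preserving the order); E i j ≡ true iff ij is an edge.
Graph : ℕ → ℕ → Set
Graph n m = Fin n → Fin m → Bool

MinDegree2 : ∀ {n m} → Graph n m → Set
MinDegree2 {n} {m} E =
  (∀ (i : Fin n) → Σ (Fin m) λ j → Σ (Fin m) λ k → j ≢ k × E i j ≡ true × E i k ≡ true) ×
  (∀ (j : Fin m) → Σ (Fin n) λ i → Σ (Fin n) λ k → i ≢ k × E i j ≡ true × E k j ≡ true)

-- index 1 or 2 of the parallel edges α_{1,i},α_{2,i} / γ_{j,1},γ_{j,2}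
data Idx : Set where
  one two : Idx

-- A route α_{a,i} β_{i,j} γ_{j,b} of G(H): data (a , i , j , b) with ij ∈ E(H)
Route : ∀ {n m} → Graph n m → Set
Route {n} {m} E = Σ (Idx × Fin n × Fin m × Idx) λ { (a , i , j , b) → E i j ≡ true }

-- Conf r r' : r and r' are in conflict in one of the forms (a),(b),(c),
-- with r playing the first route of the form.
data Conf {n m} {E : Graph n m} : Route E → Route E → Set where
  conf-a : ∀ {i j p q} → Conf ((one , i , j , two) , p) ((two , i , j , one) , q)
  conf-b : ∀ {i j k b b' p q} → j < k →
           Conf ((one , i , k , b) , p) ((two , i , j , b') , q)
  conf-c : ∀ {i i' j a a' p q} → i < i' →
           Conf ((a , i , j , two) , p) ((a' , i' , j , one) , q)

Coherent : ∀ {n m} {E : Graph n m} → Route E → Route E → Set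
Coherent r r' = ¬ Conf r r' × ¬ Conf r' r

-- sets of routes (finite, hence decidable subsets)
RouteSet : ∀ {n m} → Graph n m → Set
RouteSet E = Route E → Bool

_∈R_ : ∀ {n m} {E : Graph n m} → Route E → RouteSet E → Set
r ∈R C = C r ≡ true

IsClique : ∀ {n m} {E : Graph n m} → RouteSet E → Set
IsClique C = ∀ r r' → r ∈R C → r' ∈R C → Coherent r r'

IsMaximalClique : ∀ {n m} {E : Graph n m} → RouteSet E → Set
IsMaximalClique {E = E} C =
  IsClique C × (∀ (D : RouteSet E) → IsClique D → (∀ r → r ∈R C → r ∈R D) → ∀ r → r ∈R D → r ∈R C)

_≗R_ : ∀ {n m} {E : Graph n m} → RouteSet E → RouteSet E → Set
C ≗R D = ∀ r → C r ≡ D r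

data Sign : Set where
  plus minus : Sign

-- clique vectors: a_i ∈ N(i), a_j ∈ N(j), a_{i,j} ∈ {+,-} with + only if a_i = j and a_j = i
-- (for non-edges ij the sign is thereby forced to be minus)
record CliqueVec {n m} (E : Graph n m) : Set where
  field
    aS    : Fin n → Fin m
    aS-nb : ∀ i → E i (aS i) ≡ true
    aT    : Fin m → Fin n
    aT-nb : ∀ j → E (aT j) j ≡ true
    sgn   : Fin n → Fin m → Sign
    sgn-ok : ∀ i j → sgn i j ≡ plus → (aS i ≡ j × aT j ≡ i)
open CliqueVec public

_≈V_ : ∀ {n m} {E : Graph n m} → CliqueVec E → CliqueVec E → Set
a ≈V b = (∀ i → aS a i ≡ aS b i) × (∀ j → aT a j ≡ aT b j) × (∀ i j → sgn a i j ≡ sgn b i j)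

data Cmp : Set where
  lt eq gt : Cmp

cmpFin : ∀ {k} → Fin k → Fin k → Cmp
cmpFin x y with <-cmp x y
... | tri< _ _ _ = lt
... | tri≈ _ _ _ = eq
... | tri> _ _ _ = gt

isOne isTwo : Idx → Bool
isOne one = true
isOne two = false
isTwo one = false
isTwo two = true

-- membership of α_{x,i} β_{i,j} γ_{j,y} in φ(a), given c1 = cmp(a_i, j), c2 = cmp(a_j, i)
member : Cmp → Cmp → Sign → Idx → Idx → Bool
member lt lt _ x y = isTwo x ∧ isTwo y
member lt gt _ x y = isTwo x ∧ isOne y
member gt lt _ x y = isOne x ∧ isTwo y
member gt gt _ x y = isOne x ∧ isOne y
member eq lt _ x y = isTwo y
member eq gt _ x y = isOne y
member lt eq _ x y = isTwo x
member gt eq _ x y = isOne x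
member eq eq minus x y = not (isTwo x ∧ isOne y)
member eq eq plus  x y = not (isOne x ∧ isTwo y)

φ : ∀ {n m} {E : Graph n m} → CliqueVec E → RouteSet E
φ a ((x , i , j , y) , _) = member (cmpFin (aS a i) j) (cmpFin (aT a j) i) (sgn a i j) x y

module Submission where

-- A route α_{x,i}β_{i,j}γ_{j,y} lies in φ(a) iff x respects the threshold a_i (x = 1 needs
-- j ≤ a_i, x = 2 needs a_i ≤ j), y respects a_j in the same way, and, when a_i = j and a_j = i,
-- it is not the one route excluded by the sign a_{i,j}. Conflicts (b) and (c) are violations of
-- thresholds and conflict (a) pairs the two candidates for the excluded route, so φ(a) is a
-- clique. A clique containing φ(a) must respect the thresholds witnessed by the routes of φ(a)
-- through the edges {i, a_i} and {a_j, j}, so φ(a) is maximal; the same witnesses read a off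
-- φ(a). Conversely, in any clique the α₁-routes at i end below its α₂-routes at i, so a
-- neighbour of i separates them; choosing these thresholds and the signs accordingly gives a
-- with C ⊆ φ(a), and maximality of C forces equality.

open import Defs
open import Data.Nat using (ℕ)
open import Data.Product using (Σ; _×_)

open import Axiom.UniquenessOfIdentityProofs using (module Decidable⇒UIP)
open import Data.Bool using (Bool; true; false; _∧_; not)
open import Data.Bool.Properties using (∧-identityʳ; ⇔→≡) renaming (_≟_ to _≟ᵇ_)
open import Data.Empty using (⊥-elim)
open import Data.Fin using (Fin; zero; suc; _≤_; _<_)
open import Data.Fin.Properties using (<-cmp; _≟_; ≤-reflexive; ≤-trans; ≤-antisym; <⇒≢; any?)
import Data.Nat as ℕ
import Data.Nat.Properties as ℕ
open import Data.Product using (∃; _,_; proj₁; proj₂)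
open import Data.Sum using (_⊎_; inj₁; inj₂; [_,_]′)
open import Function using (_∘_)
open import Function.Bundles using (_⇔_; mk⇔; module Equivalence)
open import Level using (Level)
open import Relation.Binary.Definitions using (tri<; tri≈; tri>)
open import Relation.Binary.PropositionalEquality using (_≡_; refl; sym; trans; cong; cong₂; subst)
open import Relation.Nullary using (¬_; Dec; yes; no; _×-dec_; _⊎-dec_)
open import Relation.Nullary.Decidable using (map′)
open import Relation.Unary using (Pred; Decidable; _⊆_)

open Equivalence using (to; from)

private
  variable
    ℓ : Level
    k : ℕ

least : {P : Pred (Fin k) ℓ} → Decidable P → ∃ P → ∃ λ j → P j × (∀ {l} → P l → j ≤ l)
least {k = ℕ.suc _} P? (w , pw) with P? zero | w
... | yes p₀ | _ = zero , p₀ , λ _ → ℕ.z≤n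
... | no ¬p₀ | zero = ⊥-elim (¬p₀ pw)
... | no ¬p₀ | suc w′ with least (P? ∘ suc) (w′ , pw)
...   | j , pj , j-least = suc j , pj , λ { {zero} p₀ → ⊥-elim (¬p₀ p₀) ; {suc l} pl → ℕ.s≤s (j-least pl) }

greatest : {P : Pred (Fin k) ℓ} → Decidable P → ∃ P → ∃ λ j → P j × (∀ {l} → P l → l ≤ j)
greatest {k = ℕ.suc _} P? (w , pw) with any? (P? ∘ suc) | w
... | yes w′ | _ with greatest (P? ∘ suc) w′
...   | j , pj , j-greatest = suc j , pj , λ { {zero} _ → ℕ.z≤n ; {suc l} pl → ℕ.s≤s (j-greatest pl) }
greatest P? (w , pw) | no ¬∃ | zero = zero , pw , λ { {zero} _ → ℕ.z≤n ; {suc l} pl → ⊥-elim (¬∃ (l , pl)) }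
greatest P? (w , pw) | no ¬∃ | suc w′ = ⊥-elim (¬∃ (w′ , pw))

-- The largest element of L if there is one, the least element of N otherwise.
separator : {N L U : Pred (Fin k) ℓ} → Decidable N → ∃ N → Decidable L → L ⊆ N → U ⊆ N →
            (∀ {l u} → L l → U u → l ≤ u) →
            ∃ λ t → N t × (∀ {l} → L l → l ≤ t) × (∀ {u} → U u → t ≤ u)
separator N? ∃N L? L⊆N U⊆N L≤U with any? L?
... | yes ∃L with greatest L? ∃L
...   | t , Lt , t-greatest = t , L⊆N Lt , t-greatest , L≤U Lt
separator N? ∃N L? L⊆N U⊆N L≤U | no ¬∃L with least N? ∃N
...   | t , Nt , t-least = t , Nt , (λ {l} Ll → ⊥-elim (¬∃L (l , Ll))) , t-least ∘ U⊆N

-- At an edge ij with a_i = j and a_j = i, φ(a) contains three of the four routes through β_{i,j};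
-- Excluded s x y singles out the missing one α_{x,i}β_{i,j}γ_{j,y} for the sign s = a_{i,j}.
data Excluded : Sign → Idx → Idx → Set where
  plus-excludes  : Excluded plus one two
  minus-excludes : Excluded minus two one

flip : Idx → Idx
flip one = two
flip two = one

excluded-irreflexive : ∀ {s x} → ¬ Excluded s x x
excluded-irreflexive ()

excluded-flip : ∀ {s x y} → Excluded s x y → ¬ Excluded s (flip x) (flip y)
excluded-flip plus-excludes ()
excluded-flip minus-excludes ()

excluded-one-of : ∀ s → Excluded s one two ⊎ Excluded s two one
excluded-one-of plus  = inj₁ plus-excludes
excluded-one-of minus = inj₂ minus-excludes

sign-determined : ∀ {s t} → (∀ {x y} → ¬ Excluded s x y → ¬ Excluded t x y) → s ≡ t
sign-determined {plus}  {plus}  _ = refl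
sign-determined {minus} {minus} _ = refl
sign-determined {plus}  {minus} h = ⊥-elim (h (λ ()) minus-excludes)
sign-determined {minus} {plus}  h = ⊥-elim (h (λ ()) plus-excludes)

-- Allowed x aᵥ w: cases (i)–(ii) of φ let α_{x,v} (or γ_{w,x}) occur on a route through the
-- edge vw exactly when w ≤ aᵥ for x = 1 and aᵥ ≤ w for x = 2.
Allowed : Idx → Fin k → Fin k → Set
Allowed one c v = v ≤ c
Allowed two c v = c ≤ v

≡⇒allowed : ∀ x {c v : Fin k} → c ≡ v → Allowed x c v
≡⇒allowed one c≡v = ≤-reflexive (sym c≡v)
≡⇒allowed two c≡v = ≤-reflexive c≡v

allowed-sandwich : {c u v : Fin k} → Allowed one c u → Allowed two c v → u ≤ v
allowed-sandwich = ≤-trans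

partner : ∀ x (c v : Fin k) → ∃ λ y → Allowed y c v × (c ≡ v → y ≡ x)
partner x c v with <-cmp c v
... | tri< c<v _ _ = two , ℕ.<⇒≤ c<v , λ c≡v → ⊥-elim (<⇒≢ c<v c≡v)
... | tri≈ _ c≡v _ = x , ≡⇒allowed x c≡v , λ _ → refl
... | tri> _ _ v<c = one , ℕ.<⇒≤ v<c , λ c≡v → ⊥-elim (<⇒≢ v<c (sym c≡v))

data CmpView (u v : Fin k) : Cmp → Set where
  less    : u < v → CmpView u v lt
  equal   : u ≡ v → CmpView u v eq
  greater : v < u → CmpView u v gt

cmpFin-view : (u v : Fin k) → CmpView u v (cmpFin u v)
cmpFin-view u v with <-cmp u v
... | tri< u<v _ _ = less u<v
... | tri≈ _ u≡v _ = equal u≡v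
... | tri> _ _ v<u = greater v<u

allowedᵇ : Idx → Cmp → Bool
allowedᵇ x lt = isTwo x
allowedᵇ x eq = true
allowedᵇ x gt = isOne x

unexcludedᵇ : Cmp → Cmp → Sign → Idx → Idx → Bool
unexcludedᵇ eq eq plus  x y = not (isOne x ∧ isTwo y)
unexcludedᵇ eq eq minus x y = not (isTwo x ∧ isOne y)
unexcludedᵇ _  _  _     _ _ = true

member-uniform : ∀ c₁ c₂ s x y →
                 member c₁ c₂ s x y ≡ unexcludedᵇ c₁ c₂ s x y ∧ allowedᵇ x c₁ ∧ allowedᵇ y c₂
member-uniform lt lt s     x y = refl
member-uniform lt eq s     x y = sym (∧-identityʳ (isTwo x))
member-uniform lt gt s     x y = refl
member-uniform eq lt s     x y = refl
member-uniform eq eq plus  x y = sym (∧-identityʳ _)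
member-uniform eq eq minus x y = sym (∧-identityʳ _)
member-uniform eq gt s     x y = refl
member-uniform gt lt s     x y = refl
member-uniform gt eq s     x y = sym (∧-identityʳ (isOne x))
member-uniform gt gt s     x y = refl

∧≡true⇔ : ∀ {b c} → b ∧ c ≡ true ⇔ (b ≡ true × c ≡ true)
∧≡true⇔ {true}  = mk⇔ (refl ,_) proj₂
∧≡true⇔ {false} = mk⇔ (λ ()) (λ { (() , _) })

allowedᵇ⇔ : ∀ x (c v : Fin k) → allowedᵇ x (cmpFin c v) ≡ true ⇔ Allowed x c v
allowedᵇ⇔ x c v with cmpFin c v | cmpFin-view c v
allowedᵇ⇔ one c v | lt | less c<v    = mk⇔ (λ ()) (λ v≤c → ⊥-elim (ℕ.≤⇒≯ v≤c c<v))
allowedᵇ⇔ two c v | lt | less c<v    = mk⇔ (λ _ → ℕ.<⇒≤ c<v) (λ _ → refl)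
allowedᵇ⇔ x   c v | eq | equal c≡v   = mk⇔ (λ _ → ≡⇒allowed x c≡v) (λ _ → refl)
allowedᵇ⇔ one c v | gt | greater v<c = mk⇔ (λ _ → ℕ.<⇒≤ v<c) (λ _ → refl)
allowedᵇ⇔ two c v | gt | greater v<c = mk⇔ (λ ()) (λ c≤v → ⊥-elim (ℕ.≤⇒≯ c≤v v<c))

unexcludedᵇ-sound : ∀ {s x y} → unexcludedᵇ eq eq s x y ≡ true → ¬ Excluded s x y
unexcludedᵇ-sound () plus-excludes
unexcludedᵇ-sound () minus-excludes

unexcludedᵇ-complete : ∀ s x y → ¬ Excluded s x y → unexcludedᵇ eq eq s x y ≡ true
unexcludedᵇ-complete plus  one one _ = refl
unexcludedᵇ-complete plus  one two ¬e = ⊥-elim (¬e plus-excludes)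
unexcludedᵇ-complete plus  two _   _ = refl
unexcludedᵇ-complete minus one _   _ = refl
unexcludedᵇ-complete minus two one ¬e = ⊥-elim (¬e minus-excludes)
unexcludedᵇ-complete minus two two _ = refl

unexcludedᵇ⇔ : ∀ {k′} (c j : Fin k) (d i : Fin k′) s x y →
               unexcludedᵇ (cmpFin c j) (cmpFin d i) s x y ≡ true ⇔ (c ≡ j → d ≡ i → ¬ Excluded s x y)
unexcludedᵇ⇔ c j d i s x y with cmpFin c j | cmpFin-view c j | cmpFin d i | cmpFin-view d i
... | lt | less c<j    | _  | _ = mk⇔ (λ _ c≡j → ⊥-elim (<⇒≢ c<j c≡j)) (λ _ → refl)
... | gt | greater j<c | _  | _ = mk⇔ (λ _ c≡j → ⊥-elim (<⇒≢ j<c (sym c≡j))) (λ _ → refl)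
... | eq | _ | lt | less d<i    = mk⇔ (λ _ _ d≡i → ⊥-elim (<⇒≢ d<i d≡i)) (λ _ → refl)
... | eq | _ | gt | greater i<d = mk⇔ (λ _ _ d≡i → ⊥-elim (<⇒≢ i<d (sym d≡i))) (λ _ → refl)
... | eq | equal c≡j | eq | equal d≡i =
  mk⇔ (λ h _ _ → unexcludedᵇ-sound h) (λ h → unexcludedᵇ-complete s x y (h c≡j d≡i))

NoIsolatedVertex : ∀ {n m} → Graph n m → Set
NoIsolatedVertex {n} {m} E = (∀ (i : Fin n) → ∃ λ j → E i j ≡ true) × (∀ (j : Fin m) → ∃ λ i → E i j ≡ true)

minDegree2⇒noIsolatedVertex : ∀ {n m} {E : Graph n m} → MinDegree2 E → NoIsolatedVertex E
minDegree2⇒noIsolatedVertex (S-deg , T-deg) =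
  (λ i → let j , _ , _ , ij , _ = S-deg i in j , ij) ,
  (λ j → let i , _ , _ , ij , _ = T-deg j in i , ij)

module _ {n m : ℕ} {E : Graph n m} where

  _⊆R_ : RouteSet E → RouteSet E → Set
  C ⊆R D = ∀ r → r ∈R C → r ∈R D

  record Admissible (a : CliqueVec E) (x : Idx) (i : Fin n) (j : Fin m) (y : Idx) : Set where
    field
      source-allowed : Allowed x (aS a i) j
      target-allowed : Allowed y (aT a j) i
      unexcluded     : aS a i ≡ j → aT a j ≡ i → ¬ Excluded (sgn a i j) x y
  open Admissible

  ∈φ⇔ : ∀ (a : CliqueVec E) {x i j y} (p : E i j ≡ true) → ((x , i , j , y) , p) ∈R φ a ⇔ Admissible a x i j y
  ∈φ⇔ a {x} {i} {j} {y} p = mk⇔ sound complete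
    where
    c₁ = cmpFin (aS a i) j
    c₂ = cmpFin (aT a j) i
    s = sgn a i j

    sound : member c₁ c₂ s x y ≡ true → Admissible a x i j y
    sound h = record
      { source-allowed = to (allowedᵇ⇔ x (aS a i) j) ax
      ; target-allowed = to (allowedᵇ⇔ y (aT a j) i) ay
      ; unexcluded     = to (unexcludedᵇ⇔ (aS a i) j (aT a j) i s x y) u }
      where
      u,ax,ay = to ∧≡true⇔ (trans (sym (member-uniform c₁ c₂ s x y)) h)
      u = proj₁ u,ax,ay
      ax = proj₁ (to ∧≡true⇔ (proj₂ u,ax,ay))
      ay = proj₂ (to ∧≡true⇔ (proj₂ u,ax,ay))

    complete : Admissible a x i j y → member c₁ c₂ s x y ≡ true
    complete A = trans (member-uniform c₁ c₂ s x y) (cong₂ _∧_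
      (from (unexcludedᵇ⇔ (aS a i) j (aT a j) i s x y) (unexcluded A))
      (cong₂ _∧_ (from (allowedᵇ⇔ x (aS a i) j) (source-allowed A))
                 (from (allowedᵇ⇔ y (aT a j) i) (target-allowed A))))

  matched-∈φ⇔ : ∀ (a : CliqueVec E) {x i j y} (p : E i j ≡ true) → aS a i ≡ j → aT a j ≡ i →
                ((x , i , j , y) , p) ∈R φ a ⇔ (¬ Excluded (sgn a i j) x y)
  matched-∈φ⇔ a {x} {y = y} p aᵢ≡j aⱼ≡i = mk⇔
    (λ r∈ → unexcluded (to (∈φ⇔ a p) r∈) aᵢ≡j aⱼ≡i)
    (λ ¬ex → from (∈φ⇔ a p) record
      { source-allowed = ≡⇒allowed x aᵢ≡j
      ; target-allowed = ≡⇒allowed y aⱼ≡i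
      ; unexcluded     = λ _ _ → ¬ex })

  unmatched-sgn : ∀ (a : CliqueVec E) i j → ¬ (aS a i ≡ j × aT a j ≡ i) → sgn a i j ≡ minus
  unmatched-sgn a i j ¬matched with sgn a i j | sgn-ok a i j
  ... | plus  | matched = ⊥-elim (¬matched (matched refl))
  ... | minus | _       = refl

  admissible-conflict-free : ∀ {a x i j y x′ i′ j′ y′ p q} →
    Admissible a x i j y → Admissible a x′ i′ j′ y′ → ¬ Conf {E = E} ((x , i , j , y) , p) ((x′ , i′ , j′ , y′) , q)
  admissible-conflict-free {a} {i = i} {j} A B conf-a =
    [ unexcluded A aᵢ≡j aⱼ≡i , unexcluded B aᵢ≡j aⱼ≡i ]′ (excluded-one-of (sgn a i j))
    where
    aᵢ≡j = ≤-antisym (source-allowed B) (source-allowed A)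
    aⱼ≡i = ≤-antisym (target-allowed A) (target-allowed B)
  admissible-conflict-free A B (conf-b j<k) =
    ℕ.≤⇒≯ (allowed-sandwich (source-allowed A) (source-allowed B)) j<k
  admissible-conflict-free A B (conf-c i<i′) =
    ℕ.≤⇒≯ (allowed-sandwich (target-allowed B) (target-allowed A)) i<i′

  φ-isClique : ∀ (a : CliqueVec E) → IsClique (φ a)
  φ-isClique a r r′ r∈ r′∈ = conflict-free r r′ r∈ r′∈ , conflict-free r′ r r′∈ r∈
    where
    conflict-free : ∀ r r′ → r ∈R φ a → r′ ∈R φ a → ¬ Conf r r′
    conflict-free ((_ , _ , _ , _) , p) ((_ , _ , _ , _) , q) r∈ r′∈ =
      admissible-conflict-free (to (∈φ⇔ a p) r∈) (to (∈φ⇔ a q) r′∈)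

  source-witness : ∀ (a : CliqueVec E) i x → ∃ λ y → ((x , i , aS a i , y) , aS-nb a i) ∈R φ a
  source-witness a i x with partner x (aT a (aS a i)) i
  ... | y , y-allowed , y≡x = y , from (∈φ⇔ a (aS-nb a i)) record
    { source-allowed = ≡⇒allowed x refl
    ; target-allowed = y-allowed
    ; unexcluded     = λ _ aⱼ≡i ex → excluded-irreflexive (subst (Excluded _ x) (y≡x aⱼ≡i) ex) }

  target-witness : ∀ (a : CliqueVec E) j y → ∃ λ x → ((x , aT a j , j , y) , aT-nb a j) ∈R φ a
  target-witness a j y with partner y (aS a (aT a j)) j
  ... | x , x-allowed , x≡y = x , from (∈φ⇔ a (aT-nb a j)) record
    { source-allowed = x-allowed
    ; target-allowed = ≡⇒allowed y refl
    ; unexcluded     = λ aᵢ≡j _ ex → excluded-irreflexive (subst (λ z → Excluded _ z y) (x≡y aᵢ≡j) ex) }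

  excluded-incoherent : ∀ {s x i j y p q} → Excluded s x y →
                        ¬ Coherent {E = E} ((x , i , j , y) , p) ((flip x , i , j , flip y) , q)
  excluded-incoherent plus-excludes  (¬conf , _) = ¬conf conf-a
  excluded-incoherent minus-excludes (_ , ¬conf) = ¬conf conf-a

  module _ (a : CliqueVec E) {D : RouteSet E} (D-clique : IsClique D) (φa⊆D : φ a ⊆R D) where

    source-forced : ∀ {x i j y p} → ((x , i , j , y) , p) ∈R D → Allowed x (aS a i) j
    source-forced {one} {i} {j} {y} {p} r∈D with source-witness a i two
    ... | y′ , w∈ = ℕ.≮⇒≥ λ aᵢ<j → proj₁ (D-clique r w r∈D (φa⊆D w w∈)) (conf-b aᵢ<j)
      where r = (one , i , j , y) , p ; w = (two , i , aS a i , y′) , aS-nb a i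
    source-forced {two} {i} {j} {y} {p} r∈D with source-witness a i one
    ... | y′ , w∈ = ℕ.≮⇒≥ λ j<aᵢ → proj₂ (D-clique r w r∈D (φa⊆D w w∈)) (conf-b j<aᵢ)
      where r = (two , i , j , y) , p ; w = (one , i , aS a i , y′) , aS-nb a i

    target-forced : ∀ {x i j y p} → ((x , i , j , y) , p) ∈R D → Allowed y (aT a j) i
    target-forced {x} {i} {j} {one} {p} r∈D with target-witness a j two
    ... | x′ , w∈ = ℕ.≮⇒≥ λ aⱼ<i → proj₂ (D-clique r w r∈D (φa⊆D w w∈)) (conf-c aⱼ<i)
      where r = (x , i , j , one) , p ; w = (x′ , aT a j , j , two) , aT-nb a j
    target-forced {x} {i} {j} {two} {p} r∈D with target-witness a j one
    ... | x′ , w∈ = ℕ.≮⇒≥ λ i<aⱼ → proj₁ (D-clique r w r∈D (φa⊆D w w∈)) (conf-c i<aⱼ)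
      where r = (x , i , j , two) , p ; w = (x′ , aT a j , j , one) , aT-nb a j

    unexcluded-forced : ∀ {x i j y p} → ((x , i , j , y) , p) ∈R D →
                        aS a i ≡ j → aT a j ≡ i → ¬ Excluded (sgn a i j) x y
    unexcluded-forced {x} {i} {j} {y} {p} r∈D aᵢ≡j aⱼ≡i ex = excluded-incoherent ex
      (D-clique r r′ r∈D (φa⊆D r′ (from (matched-∈φ⇔ a p aᵢ≡j aⱼ≡i) (excluded-flip ex))))
      where r = (x , i , j , y) , p ; r′ = (flip x , i , j , flip y) , p

    clique-⊆φ : D ⊆R φ a
    clique-⊆φ ((x , i , j , y) , p) r∈D = from (∈φ⇔ a p) record
      { source-allowed = source-forced r∈D
      ; target-allowed = target-forced r∈D
      ; unexcluded     = unexcluded-forced r∈D }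

  φ-isMaximalClique : ∀ (a : CliqueVec E) → IsMaximalClique (φ a)
  φ-isMaximalClique a = φ-isClique a , λ D D-clique φa⊆D → clique-⊆φ a D-clique φa⊆D

  ⊆φ⇒aS-≥ : ∀ (a b : CliqueVec E) → φ a ⊆R φ b → ∀ i → aS b i ≤ aS a i
  ⊆φ⇒aS-≥ a b a⊆b i with source-witness a i two
  ... | y , w∈ = source-allowed (to (∈φ⇔ b (aS-nb a i)) (a⊆b ((two , i , aS a i , y) , aS-nb a i) w∈))

  ⊆φ⇒aT-≥ : ∀ (a b : CliqueVec E) → φ a ⊆R φ b → ∀ j → aT b j ≤ aT a j
  ⊆φ⇒aT-≥ a b a⊆b j with target-witness a j two
  ... | x , w∈ = target-allowed (to (∈φ⇔ b (aT-nb a j)) (a⊆b ((x , aT a j , j , two) , aT-nb a j) w∈))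

  φ-injective : ∀ (a b : CliqueVec E) → φ a ≗R φ b → a ≈V b
  φ-injective a b φa≗φb = aS≡ , aT≡ , sgn≡
    where
    a⊆b : φ a ⊆R φ b
    a⊆b r = trans (sym (φa≗φb r))
    b⊆a : φ b ⊆R φ a
    b⊆a r = trans (φa≗φb r)

    aS≡ : ∀ i → aS a i ≡ aS b i
    aS≡ i = ≤-antisym (⊆φ⇒aS-≥ b a b⊆a i) (⊆φ⇒aS-≥ a b a⊆b i)
    aT≡ : ∀ j → aT a j ≡ aT b j
    aT≡ j = ≤-antisym (⊆φ⇒aT-≥ b a b⊆a j) (⊆φ⇒aT-≥ a b a⊆b j)

    sgn≡ : ∀ i j → sgn a i j ≡ sgn b i j
    sgn≡ i j with aS a i ≟ j ×-dec aT a j ≟ i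
    ... | yes (aᵢ≡j , aⱼ≡i) = sign-determined λ {x} {y} ¬ex →
      to (matched-∈φ⇔ b p (trans (sym (aS≡ i)) aᵢ≡j) (trans (sym (aT≡ j)) aⱼ≡i))
         (a⊆b ((x , i , j , y) , p) (from (matched-∈φ⇔ a p aᵢ≡j aⱼ≡i) ¬ex))
      where p = subst (λ k → E i k ≡ true) aᵢ≡j (aS-nb a i)
    ... | no ¬matched = trans (unmatched-sgn a i j ¬matched)
      (sym (unmatched-sgn b i j λ (bᵢ≡j , bⱼ≡i) → ¬matched (trans (aS≡ i) bᵢ≡j , trans (aT≡ j) bⱼ≡i)))

  module FromClique (E-noIsolated : NoIsolatedVertex E) (C : RouteSet E) (C-clique : IsClique C) where

    Has : Idx → Fin n → Fin m → Idx → Set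
    Has x i j y = Σ (E i j ≡ true) λ p → ((x , i , j , y) , p) ∈R C

    has? : ∀ x i j y → Dec (Has x i j y)
    has? x i j y with E i j ≟ᵇ true
    ... | no ¬ij = no (¬ij ∘ proj₁)
    ... | yes ij = map′ (ij ,_) (λ (ij′ , h) → trans (cong (λ q → C ((x , i , j , y) , q)) (≡-irrelevant ij ij′)) h)
                        (C ((x , i , j , y) , ij) ≟ᵇ true)
      where open Decidable⇒UIP _≟ᵇ_ using (≡-irrelevant)

    Leaves : Idx → Fin n → Pred (Fin m) _
    Leaves x i j = ∃ λ y → Has x i j y
    Enters : Idx → Fin m → Pred (Fin n) _
    Enters y j i = ∃ λ x → Has x i j y

    ∃-Idx? : {P : Idx → Set} → Dec (P one) → Dec (P two) → Dec (∃ P)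
    ∃-Idx? p₁? p₂? = map′ [ (one ,_) , (two ,_) ]′ (λ { (one , p) → inj₁ p ; (two , p) → inj₂ p }) (p₁? ⊎-dec p₂?)

    source-separation : ∀ i → ∃ λ t → E i t ≡ true ×
                        (∀ {j} → Leaves one i j → j ≤ t) × (∀ {j} → Leaves two i j → t ≤ j)
    source-separation i = separator (λ j → E i j ≟ᵇ true) (proj₁ E-noIsolated i)
      (λ j → ∃-Idx? (has? one i j one) (has? one i j two)) (proj₁ ∘ proj₂) (proj₁ ∘ proj₂)
      λ (_ , _ , l∈) (_ , _ , u∈) → ℕ.≮⇒≥ λ u<l → proj₁ (C-clique _ _ l∈ u∈) (conf-b u<l)

    target-separation : ∀ j → ∃ λ t → E t j ≡ true ×
                        (∀ {i} → Enters one j i → i ≤ t) × (∀ {i} → Enters two j i → t ≤ i)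
    target-separation j = separator (λ i → E i j ≟ᵇ true) (proj₂ E-noIsolated j)
      (λ i → ∃-Idx? (has? one i j one) (has? two i j one)) (proj₁ ∘ proj₂) (proj₁ ∘ proj₂)
      λ (_ , _ , l∈) (_ , _ , u∈) → ℕ.≮⇒≥ λ u<l → proj₁ (C-clique _ _ u∈ l∈) (conf-c u<l)

    thresholdS : Fin n → Fin m
    thresholdS i = proj₁ (source-separation i)
    thresholdT : Fin m → Fin n
    thresholdT j = proj₁ (target-separation j)

    signOf : ∀ {P : Set} → Dec P → Sign
    signOf (yes _) = plus
    signOf (no _)  = minus

    sign : Fin n → Fin m → Sign
    sign i j = signOf ((thresholdS i ≟ j ×-dec thresholdT j ≟ i) ×-dec has? two i j one)

    sign-plus : ∀ i j → sign i j ≡ plus → thresholdS i ≡ j × thresholdT j ≡ i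
    sign-plus i j with (thresholdS i ≟ j ×-dec thresholdT j ≟ i) ×-dec has? two i j one
    ... | yes (matched , _) = λ _ → matched
    ... | no _              = λ ()

    vector : CliqueVec E
    vector = record
      { aS = thresholdS ; aS-nb = proj₁ ∘ proj₂ ∘ source-separation
      ; aT = thresholdT ; aT-nb = proj₁ ∘ proj₂ ∘ target-separation
      ; sgn = sign ; sgn-ok = sign-plus }

    source-in-range : ∀ {x i j y p} → ((x , i , j , y) , p) ∈R C → Allowed x (thresholdS i) j
    source-in-range {one} {i} {y = y} {p} r∈ = proj₁ (proj₂ (proj₂ (source-separation i))) (y , p , r∈)
    source-in-range {two} {i} {y = y} {p} r∈ = proj₂ (proj₂ (proj₂ (source-separation i))) (y , p , r∈)

    target-in-range : ∀ {x i j y p} → ((x , i , j , y) , p) ∈R C → Allowed y (thresholdT j) i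
    target-in-range {x} {j = j} {one} {p} r∈ = proj₁ (proj₂ (proj₂ (target-separation j))) (x , p , r∈)
    target-in-range {x} {j = j} {two} {p} r∈ = proj₂ (proj₂ (proj₂ (target-separation j))) (x , p , r∈)

    unexcluded-in : ∀ {x i j y p} → ((x , i , j , y) , p) ∈R C →
                    thresholdS i ≡ j → thresholdT j ≡ i → ¬ Excluded (sign i j) x y
    unexcluded-in {i = i} {j} {p = p} r∈ aᵢ≡j aⱼ≡i ex
      with (thresholdS i ≟ j ×-dec thresholdT j ≟ i) ×-dec has? two i j one | ex
    ... | yes (_ , q , flipped∈) | plus-excludes  = proj₁ (C-clique _ ((two , i , j , one) , q) r∈ flipped∈) conf-a
    ... | no ¬plus               | minus-excludes = ¬plus ((aᵢ≡j , aⱼ≡i) , p , r∈)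

    clique-⊆φ-vector : C ⊆R φ vector
    clique-⊆φ-vector ((x , i , j , y) , p) r∈ = from (∈φ⇔ vector p) record
      { source-allowed = source-in-range r∈
      ; target-allowed = target-in-range r∈
      ; unexcluded     = unexcluded-in r∈ }

  φ-surjective : NoIsolatedVertex E → ∀ C → IsMaximalClique C → Σ (CliqueVec E) λ a → φ a ≗R C
  φ-surjective E-noIsolated C (C-clique , C-maximal) = vector , λ r →
    ⇔→≡ (mk⇔ (C-maximal (φ vector) (φ-isClique vector) clique-⊆φ-vector r) (clique-⊆φ-vector r))
    where open FromClique E-noIsolated C C-clique

theorem3p6 : (n m : ℕ) (E : Graph n m) → MinDegree2 E →
    ((a : CliqueVec E) → IsMaximalClique (φ a)) ×
    ((a b : CliqueVec E) → φ a ≗R φ b → a ≈V b) ×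
    ((C : RouteSet E) → IsMaximalClique C → Σ (CliqueVec E) λ a → φ a ≗R C)
theorem3p6 n m E deg =
  φ-isMaximalClique , φ-injective , φ-surjective (minDegree2⇒noIsolatedVertex deg)
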